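{- Let $G$ be a finite simple undirected graph, let $\mathcal{P}$ be a clique partition of $G$ of minimum weight, and let $C\in\mathcal{P}$ be a largest clique of $\mathcal{P}$. Then $C$ is a maximal clique of $G$ (i.e. no vertex outside $C$ is adjacent to all vertices of $C$).
   Context: A clique partition of $G$ is a partition of $V(G)$ into sets each of which is a clique in $G$. The weight of a clique partition $\{P_1,\dots,P_k\}$ is $\prod_{i=1}^{k}(|P_i|+1)$. -}

module Defs where

open import Data.Nat using (ℕ; suc; _≤_)
open import Data.Fin using (Fin; _≟_)
open import Data.List using (List; length; filter; map; allFin)
open import Data.Nat.ListAction using (product)
open import Data.Product using (∃)
open import Relation.Binary.PropositionalEquality using (_≡_; _≢_)
open import Relation.Nullary using (¬_; Dec)

record SimpleGraph (n : ℕ) : Set₁ where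
  field
    Adj    : Fin n → Fin n → Set
    adj?   : (u v : Fin n) → Dec (Adj u v)
    sym    : ∀ {u v} → Adj u v → Adj v u
    irrefl : ∀ {u} → ¬ Adj u u
open SimpleGraph public

VSet : ℕ → Set₁
VSet n = Fin n → Set

IsClique : ∀ {n} → SimpleGraph n → VSet n → Set
IsClique G S = ∀ u v → S u → S v → u ≢ v → Adj G u v

IsMaximalClique : ∀ {n} → SimpleGraph n → VSet n → Set
IsMaximalClique G S =
  IsClique G S × ¬ (∃ λ v → ¬ S v × (∀ u → S u → Adj G v u))
  where open import Data.Product using (_×_)

-- A partition of Fin n into k blocks is given by a block-assignment
-- f : Fin n → Fin k; block i is the preimage of i.  Every block must be
-- nonempty (f surjective), so the blocks are exactly the parts.
Block : ∀ {n k} → (Fin n → Fin k) → Fin k → VSet n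
Block f i v = f v ≡ i

blockSize : ∀ {n k} → (Fin n → Fin k) → Fin k → ℕ
blockSize {n} f i = length (filter (λ v → f v ≟ i) (allFin n))

record CliquePartition {n} (G : SimpleGraph n) : Set where
  field
    k        : ℕ
    part     : Fin n → Fin k
    nonempty : ∀ i → ∃ λ v → part v ≡ i
    clique   : ∀ i → IsClique G (Block part i)
open CliquePartition public

weight : ∀ {n} {G : SimpleGraph n} → CliquePartition G → ℕ
weight P = product (map (λ i → suc (blockSize (part P) i)) (allFin (k P)))

IsMinWeight : ∀ {n} {G : SimpleGraph n} → CliquePartition G → Set
IsMinWeight {G = G} P = ∀ (Q : CliquePartition G) → weight P ≤ weight Q

IsLargestBlock : ∀ {n} {G : SimpleGraph n} → (P : CliquePartition G) → Fin (k P) → Set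
IsLargestBlock P c = ∀ j → blockSize (part P) j ≤ blockSize (part P) c

-- Suppose a vertex v outside the largest block C of a minimum-weight clique
-- partition is adjacent to all of C.  Moving v into C keeps every block a clique
-- and changes the factors (|C| + 1)(|B| + 1) of C and of v's old block B into
-- (|C| + 2)|B|, which is smaller by |C| + 1 − |B| > 0.  If B = {v} the new
-- block assignment has an empty block, but empty blocks contribute the factor 1
-- and can be discarded, so the result is a clique partition of smaller weight.
module Submission where

open import Defs hiding (sym)
open import Data.Bool using (true; false)
open import Data.Fin using (Fin; zero; suc; _≟_; punchIn; punchOut)
open import Data.Fin.Properties
  using (suc-injective; punchIn-punchOut; punchInᵢ≢i; punchIn-injective; all?; any?; ¬∀⟶∃¬)
open import Data.List using (List; []; _∷_; length; filter; map; tabulate; allFin)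
open import Data.List.Properties
  using (filter-accept; filter-reject; filter-≐; filter-none; map-tabulate; tabulate-cong)
open import Data.List.Relation.Unary.All.Properties using (tabulate⁺)
open import Data.Nat using (ℕ; zero; suc; _+_; _*_; _≤_; _<_; NonZero)
open import Data.Nat.ListAction using (product)
open import Data.Nat.ListAction.Properties using (product≢0)
open import Data.Nat.Properties
  using (*-assoc; *-identityˡ; *-monoˡ-<; +-monoˡ-<; <-irrefl; *-commutativeSemigroup; module ≤-Reasoning)
open import Algebra.Properties.CommutativeSemigroup *-commutativeSemigroup using (x∙yz≈y∙xz)
open import Data.Nat.Tactic.RingSolver using (solve-∀)
open import Data.Product using (Σ-syntax; ∃; _×_; _,_; curry)
open import Function using (_∘_; id)
open import Relation.Binary.PropositionalEquality
  using (_≡_; _≢_; refl; sym; trans; cong; cong₂; subst; module ≡-Reasoning)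
open import Relation.Nullary using (¬_; Dec; does; yes; no; contradiction)
open import Relation.Unary using (Pred; Decidable; _≐_)

count : ∀ {n p} {P : Pred (Fin n) p} → Decidable P → ℕ
count {n} P? = length (filter P? (allFin n))

length-filter-map : ∀ {a b p} {A : Set a} {B : Set b} {P : Pred B p} (P? : Decidable P)
  (h : A → B) (xs : List A) → length (filter P? (map h xs)) ≡ length (filter (P? ∘ h) xs)
length-filter-map P? h [] = refl
length-filter-map P? h (x ∷ xs) with does (P? (h x))
... | true  = cong suc (length-filter-map P? h xs)
... | false = length-filter-map P? h xs

module _ {n p} {P : Pred (Fin (suc n)) p} (P? : Decidable P) where

  private
    count-tail : length (filter P? (tabulate suc)) ≡ count (P? ∘ suc)
    count-tail = trans (cong (length ∘ filter P?) (sym (map-tabulate id suc)))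
                       (length-filter-map P? suc (allFin n))

  count-accept : P zero → count P? ≡ suc (count (P? ∘ suc))
  count-accept P0 = trans (cong length (filter-accept P? P0)) (cong suc count-tail)

  count-reject : ¬ P zero → count P? ≡ count (P? ∘ suc)
  count-reject ¬P0 = trans (cong length (filter-reject P? ¬P0)) count-tail

module _ {n p q} {P : Pred (Fin n) p} {Q : Pred (Fin n) q} (P? : Decidable P) (Q? : Decidable Q) where

  count-cong : P ≐ Q → count P? ≡ count Q?
  count-cong P≐Q = cong length (filter-≐ P? Q? P≐Q (allFin n))

count-none : ∀ {n p} {P : Pred (Fin n) p} (P? : Decidable P) → (∀ u → ¬ P u) → count P? ≡ 0
count-none P? ¬P = cong length (filter-none P? (tabulate⁺ ¬P))

count-insert : ∀ {n p q} {P : Pred (Fin n) p} {Q : Pred (Fin n) q}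
  (P? : Decidable P) (Q? : Decidable Q) {v : Fin n} → ¬ P v → Q v →
  (∀ u → u ≢ v → P u → Q u) → (∀ u → u ≢ v → Q u → P u) → count Q? ≡ suc (count P?)
count-insert {P = P} {Q} P? Q? {zero} ¬Pv Qv P⊆Q Q⊆P = begin
  count Q?                ≡⟨ count-accept Q? Qv ⟩
  suc (count (Q? ∘ suc))  ≡⟨ cong suc (count-cong (Q? ∘ suc) (P? ∘ suc) Q∘suc≐P∘suc) ⟩
  suc (count (P? ∘ suc))  ≡⟨ cong suc (count-reject P? ¬Pv) ⟨
  suc (count P?)          ∎
  where
  open ≡-Reasoning
  Q∘suc≐P∘suc : (Q ∘ suc) ≐ (P ∘ suc)
  Q∘suc≐P∘suc = (λ {u} → Q⊆P (suc u) λ ()) , (λ {u} → P⊆Q (suc u) λ ())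
count-insert {P = P} P? Q? {suc v} ¬Pv Qv P⊆Q Q⊆P = by-cases (P? zero)
  where
  open ≡-Reasoning
  tail : count (Q? ∘ suc) ≡ suc (count (P? ∘ suc))
  tail = count-insert (P? ∘ suc) (Q? ∘ suc) ¬Pv Qv
           (λ u u≢v → P⊆Q (suc u) (u≢v ∘ suc-injective))
           (λ u u≢v → Q⊆P (suc u) (u≢v ∘ suc-injective))
  by-cases : Dec (P zero) → count Q? ≡ suc (count P?)
  by-cases (yes P0) = begin
    count Q?                      ≡⟨ count-accept Q? (P⊆Q zero (λ ()) P0) ⟩
    suc (count (Q? ∘ suc))        ≡⟨ cong suc tail ⟩
    suc (suc (count (P? ∘ suc)))  ≡⟨ cong suc (count-accept P? P0) ⟨
    suc (count P?)                ∎
  by-cases (no ¬P0) = begin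
    count Q?                ≡⟨ count-reject Q? (¬P0 ∘ Q⊆P zero (λ ())) ⟩
    count (Q? ∘ suc)        ≡⟨ tail ⟩
    suc (count (P? ∘ suc))  ≡⟨ cong suc (count-reject P? ¬P0) ⟨
    suc (count P?)          ∎

∏ : ∀ {k} → (Fin k → ℕ) → ℕ
∏ g = product (tabulate g)

∏-cong : ∀ {k} {g h : Fin k → ℕ} → (∀ i → g i ≡ h i) → ∏ g ≡ ∏ h
∏-cong g≗h = cong product (tabulate-cong g≗h)

∏-nonZero : ∀ {k} {g : Fin k → ℕ} → (∀ i → NonZero (g i)) → NonZero (∏ g)
∏-nonZero nz = product≢0 (tabulate⁺ nz)

∏-punchIn : ∀ {k} (g : Fin (suc k) → ℕ) (i : Fin (suc k)) → ∏ g ≡ g i * ∏ (g ∘ punchIn i)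
∏-punchIn g zero = refl
∏-punchIn {suc k} g (suc i) = begin
  g zero * ∏ (g ∘ suc)                             ≡⟨ cong (g zero *_) (∏-punchIn (g ∘ suc) i) ⟩
  g zero * (g (suc i) * ∏ (g ∘ suc ∘ punchIn i))   ≡⟨ x∙yz≈y∙xz (g zero) (g (suc i)) _ ⟩
  g (suc i) * (g zero * ∏ (g ∘ suc ∘ punchIn i))   ∎
  where open ≡-Reasoning

∏-punchIn₂ : ∀ {k} (g : Fin (suc (suc k)) → ℕ) {c j} (c≢j : c ≢ j) →
  ∏ g ≡ g c * g j * ∏ (g ∘ punchIn c ∘ punchIn (punchOut c≢j))
∏-punchIn₂ {k} g {c} {j} c≢j = begin
  ∏ g                                      ≡⟨ ∏-punchIn g c ⟩
  g c * ∏ (g ∘ punchIn c)                  ≡⟨ cong (g c *_) (∏-punchIn (g ∘ punchIn c) j′) ⟩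
  g c * (g (punchIn c j′) * ∏ (g ∘ rest))  ≡⟨ cong (λ x → g c * (g x * ∏ (g ∘ rest))) (punchIn-punchOut c≢j) ⟩
  g c * (g j * ∏ (g ∘ rest))               ≡⟨ *-assoc (g c) (g j) _ ⟨
  g c * g j * ∏ (g ∘ rest)                 ∎
  where
  open ≡-Reasoning
  j′ : Fin (suc k)
  j′ = punchOut c≢j
  rest : Fin k → Fin (suc (suc k))
  rest = punchIn c ∘ punchIn j′

∏-<-twoPoints : ∀ {k} {g h : Fin k → ℕ} {c j : Fin k} → c ≢ j → (∀ i → NonZero (h i)) →
  (∀ i → i ≢ c → i ≢ j → g i ≡ h i) → g c * g j < h c * h j → ∏ g < ∏ h
∏-<-twoPoints {suc zero} {c = zero} {zero} c≢j _ _ _ = contradiction refl c≢j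
∏-<-twoPoints {suc (suc k)} {g} {h} {c} {j} c≢j nz agree gcj<hcj = begin-strict
  ∏ g                       ≡⟨ ∏-punchIn₂ g c≢j ⟩
  g c * g j * ∏ (g ∘ rest)  ≡⟨ cong (g c * g j *_) (∏-cong λ i → agree (rest i) (rest≢c i) (rest≢j i)) ⟩
  g c * g j * ∏ (h ∘ rest)  <⟨ *-monoˡ-< (∏ (h ∘ rest)) {{∏-nonZero (nz ∘ rest)}} gcj<hcj ⟩
  h c * h j * ∏ (h ∘ rest)  ≡⟨ ∏-punchIn₂ h c≢j ⟨
  ∏ h                       ∎
  where
  open ≤-Reasoning
  j′ : Fin (suc k)
  j′ = punchOut c≢j
  rest : Fin k → Fin (suc (suc k))
  rest = punchIn c ∘ punchIn j′
  rest≢c : ∀ i → rest i ≢ c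
  rest≢c i = punchInᵢ≢i c _
  rest≢j : ∀ i → rest i ≢ j
  rest≢j i e = punchInᵢ≢i j′ i (punchIn-injective c _ _ (trans e (sym (punchIn-punchOut c≢j))))

-- Unlike a CliquePartition, such an assignment may leave blocks empty.
IsCliqueAssignment : ∀ {n k} → SimpleGraph n → (Fin n → Fin k) → Set
IsCliqueAssignment G f = ∀ i → IsClique G (Block f i)

weightOf : ∀ {n k} → (Fin n → Fin k) → ℕ
weightOf f = ∏ (λ i → suc (blockSize f i))

weight≡weightOf : ∀ {n} {G : SimpleGraph n} (P : CliquePartition G) → weight P ≡ weightOf (part P)
weight≡weightOf P = cong product (map-tabulate id (λ i → suc (blockSize (part P) i)))

module _ {n k} (f : Fin n → Fin (suc k)) {i : Fin (suc k)}
         (empty : ∀ u → f u ≢ i) where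

  dropBlock : Fin n → Fin k
  dropBlock u = punchOut (empty u ∘ sym)

  punchIn-dropBlock : ∀ u → punchIn i (dropBlock u) ≡ f u
  punchIn-dropBlock u = punchIn-punchOut _

  dropBlock-clique : ∀ {G} → IsCliqueAssignment G f → IsCliqueAssignment G dropBlock
  dropBlock-clique cl i′ x y x∈i′ y∈i′ =
    cl (punchIn i i′) x y (to-f x x∈i′) (to-f y y∈i′)
    where
    to-f : ∀ u → dropBlock u ≡ i′ → f u ≡ punchIn i i′
    to-f u e = trans (sym (punchIn-dropBlock u)) (cong (punchIn i) e)

  blockSize-dropBlock : ∀ i′ → blockSize dropBlock i′ ≡ blockSize f (punchIn i i′)
  blockSize-dropBlock i′ = count-cong _ _
    ( (λ {u} e → trans (sym (punchIn-dropBlock u)) (cong (punchIn i) e))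
    , (λ {u} e → punchIn-injective i _ _ (trans (punchIn-dropBlock u) e)) )

  weightOf-dropBlock : weightOf f ≡ weightOf dropBlock
  weightOf-dropBlock = begin
    weightOf f                                                         ≡⟨ ∏-punchIn (λ i → suc (blockSize f i)) i ⟩
    suc (blockSize f i) * ∏ (λ i′ → suc (blockSize f (punchIn i i′)))  ≡⟨ cong₂ _*_ (cong suc (count-none (λ u → f u ≟ i) empty))
                                                                            (∏-cong λ i′ → cong suc (sym (blockSize-dropBlock i′))) ⟩
    1 * weightOf dropBlock                                             ≡⟨ *-identityˡ _ ⟩
    weightOf dropBlock                                                 ∎
    where open ≡-Reasoning

withNonemptyBlocks : ∀ {n k} {G : SimpleGraph n} (f : Fin n → Fin k) → (∀ i → ∃ λ u → f u ≡ i) →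
  IsCliqueAssignment G f → Σ[ Q ∈ CliquePartition G ] weight Q ≡ weightOf f
withNonemptyBlocks {k = k} {G} f nonempty cl = P , weight≡weightOf P
  where
  P : CliquePartition G
  P = record { k = k ; part = f ; nonempty = nonempty ; clique = cl }

toCliquePartition : ∀ {n k} {G : SimpleGraph n} (f : Fin n → Fin k) → IsCliqueAssignment G f →
  Σ[ Q ∈ CliquePartition G ] weight Q ≡ weightOf f
toCliquePartition {k = zero} f cl = withNonemptyBlocks f (λ ()) cl
toCliquePartition {k = suc k} {G} f cl with all? (λ i → any? (λ u → f u ≟ i))
... | yes nonempty = withNonemptyBlocks f nonempty cl
... | no ¬nonempty = withoutEmptyBlock (¬∀⟶∃¬ _ _ (λ i → any? (λ u → f u ≟ i)) ¬nonempty)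
  where
  withoutEmptyBlock : ∃ (λ i → ¬ ∃ λ u → f u ≡ i) → Σ[ Q ∈ CliquePartition G ] weight Q ≡ weightOf f
  withoutEmptyBlock (i , i-empty)
    with Q , weight-Q ← toCliquePartition (dropBlock f (curry i-empty)) (dropBlock-clique f (curry i-empty) {G} cl)
    = Q , trans weight-Q (sym (weightOf-dropBlock f (curry i-empty)))

*-unbalance-< : ∀ {a b} → b < a → suc (suc a) * suc b < suc a * suc (suc b)
*-unbalance-< {a} {b} b<a = begin-strict
  suc (suc a) * suc b  ≡⟨ expand₁ a b ⟩
  b + m                <⟨ +-monoˡ-< m b<a ⟩
  a + m                ≡⟨ expand₂ a b ⟨
  suc a * suc (suc b)  ∎
  where
  open ≤-Reasoning
  m : ℕ
  m = 2 + a + b + a * b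
  expand₁ : ∀ a b → suc (suc a) * suc b ≡ b + (2 + a + b + a * b)
  expand₁ = solve-∀
  expand₂ : ∀ a b → suc a * suc (suc b) ≡ a + (2 + a + b + a * b)
  expand₂ = solve-∀

moveTo : ∀ {n k} → (Fin n → Fin k) → Fin n → Fin k → Fin n → Fin k
moveTo f v c u with u ≟ v
... | yes _ = c
... | no _  = f u

module _ {n k} (f : Fin n → Fin k) (v : Fin n) (c : Fin k) where

  moveTo-self : moveTo f v c v ≡ c
  moveTo-self with v ≟ v
  ... | yes _   = refl
  ... | no v≢v = contradiction refl v≢v

  moveTo-other : ∀ {u} → u ≢ v → moveTo f v c u ≡ f u
  moveTo-other {u} u≢v with u ≟ v
  ... | yes u≡v = contradiction u≡v u≢v
  ... | no _    = refl

  moveTo-clique : ∀ {G} → IsCliqueAssignment G f → (∀ u → f u ≡ c → Adj G v u) →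
    IsCliqueAssignment G (moveTo f v c)
  moveTo-clique {G} cl v~c i x y x∈i y∈i x≢y with x ≟ v | y ≟ v
  ... | yes refl | yes refl = contradiction refl x≢y
  ... | yes refl | no _     = v~c y (trans y∈i (sym x∈i))
  ... | no _     | yes refl = SimpleGraph.sym G (v~c x (trans x∈i (sym y∈i)))
  ... | no _     | no _     = cl i x y x∈i y∈i x≢y

  module _ (v∉c : f v ≢ c) where

    blockSize-moveTo-target : blockSize (moveTo f v c) c ≡ suc (blockSize f c)
    blockSize-moveTo-target = count-insert (λ u → f u ≟ c) (λ u → moveTo f v c u ≟ c) v∉c moveTo-self
      (λ u u≢v → trans (moveTo-other u≢v)) (λ u u≢v → trans (sym (moveTo-other u≢v)))

    blockSize-moveTo-source : blockSize f (f v) ≡ suc (blockSize (moveTo f v c) (f v))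
    blockSize-moveTo-source = count-insert (λ u → moveTo f v c u ≟ f v) (λ u → f u ≟ f v)
      (λ v∈fv → v∉c (trans (sym v∈fv) moveTo-self)) refl
      (λ u u≢v → trans (sym (moveTo-other u≢v))) (λ u u≢v → trans (moveTo-other u≢v))

    blockSize-moveTo-other : ∀ {i} → i ≢ c → i ≢ f v → blockSize (moveTo f v c) i ≡ blockSize f i
    blockSize-moveTo-other {i} i≢c i≢fv = count-cong _ _ ((λ {u} → to u) , (λ {u} → from u))
      where
      to : ∀ u → moveTo f v c u ≡ i → f u ≡ i
      to u u∈i with u ≟ v
      ... | yes refl = contradiction u∈i (i≢c ∘ sym)
      ... | no _     = u∈i
      from : ∀ u → f u ≡ i → moveTo f v c u ≡ i
      from u u∈i with u ≟ v
      ... | yes refl = contradiction u∈i (i≢fv ∘ sym)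
      ... | no _     = u∈i

    weightOf-moveTo-< : blockSize f (f v) ≤ blockSize f c → weightOf (moveTo f v c) < weightOf f
    weightOf-moveTo-< source≤target =
      ∏-<-twoPoints (v∉c ∘ sym) (λ _ → _) (λ i i≢c i≢fv → cong suc (blockSize-moveTo-other i≢c i≢fv)) factors-<
      where
      open ≤-Reasoning
      a b : ℕ
      a = blockSize f c
      b = blockSize (moveTo f v c) (f v)
      factors-< : suc (blockSize (moveTo f v c) c) * suc b < suc a * suc (blockSize f (f v))
      factors-< = begin-strict
        suc (blockSize (moveTo f v c) c) * suc b  ≡⟨ cong (λ x → suc x * suc b) blockSize-moveTo-target ⟩
        suc (suc a) * suc b                       <⟨ *-unbalance-< (subst (_≤ a) blockSize-moveTo-source source≤target) ⟩
        suc a * suc (suc b)                       ≡⟨ cong (λ y → suc a * suc y) blockSize-moveTo-source ⟨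
        suc a * suc (blockSize f (f v))           ∎

lemma6 : ∀ {n} (G : SimpleGraph n) (P : CliquePartition G) (c : Fin (k P))
    → IsMinWeight P → IsLargestBlock P c
    → IsMaximalClique G (Block (part P) c)
lemma6 {n} G P c minimum largest = clique P c , noExtension
  where
  f : Fin n → Fin (k P)
  f = part P
  noExtension : ¬ ∃ λ v → f v ≢ c × (∀ u → f u ≡ c → Adj G v u)
  noExtension (v , v∉c , v~c)
    with Q , weight-Q ← toCliquePartition {G = G} (moveTo f v c) (moveTo-clique f v c {G} (clique P) v~c)
    = <-irrefl refl (begin-strict
      weight Q                 ≡⟨ weight-Q ⟩
      weightOf (moveTo f v c)  <⟨ weightOf-moveTo-< f v c v∉c (largest (f v)) ⟩
      weightOf f               ≡⟨ weight≡weightOf P ⟨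
      weight P                 ≤⟨ minimum Q ⟩
      weight Q                 ∎)
    where open ≤-Reasoning
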